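{- Let $\Gamma$ be a finite connected graph and let $G\le\mathrm{Aut}(\Gamma)$ act regularly on the arcs of $\Gamma$. Let $H\le\mathrm{Aut}(\Gamma)$ be such that $G\le H$ and $(G_v^{\Gamma(v)},H_v^{\Gamma(v)})$ is a complete colour pair for every vertex $v$ of $\Gamma$. Then $H$ is a colour-preserving group of automorphisms of $\mathcal{L}(\mathcal{S}(\Gamma))$, the line graph of the subdivision graph of $\Gamma$, viewed as a Cayley graph on $G$ (via the regular action of $G$ on the edges of $\mathcal{S}(\Gamma)$: fixing an edge $e$ of $\mathcal{S}(\Gamma)$ and identifying $e^g$ with $g$).
   Context: All groups and graphs are finite. $\mathcal{S}(\Gamma)$ is obtained by subdividing each edge of $\Gamma$ once; $\mathcal{L}$ denotes the line graph. For a group $G$ and inverse-closed $S\subseteq G$, $\mathrm{Cay}(G,S)$ is the edge-coloured graph on $G$ with edges $\{g,sg\}$ ($g\in G,s\in S$) coloured $\{s,s^{ -1}\}$; colour-preserving automorphisms map each edge to an edge of the same colour, and $\mathrm{Aut}_c$ is the group of them. $\Gamma(v)$ is the neighbourhood of $v$ and $X_v^{\Gamma(v)}$ is the permutation group induced on $\Gamma(v)$ by the stabiliser $X_v$. $\mathrm{K}_G=\mathrm{Cay}(G,G\setminus\{1\})$. A generalised dicyclic group over an abelian group $A$ of even order and exponent greater than $2$ with an involution $y\in A$ is $\langle A,x\mid x^2=y,\ x^{ -1}ax=a^{ -1}\ \forall a\in A\rangle$. A pair $(G,B)$, where $B$ is a permutation group on a set $\Delta$ and $G$ is a regular subgroup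 of $B$, is a complete colour pair if (a) $G$ is either an abelian group that is not an elementary abelian $2$-group, or a generalised dicyclic group, and (b) under some bijection $\Delta\to G$ carrying the action of $G$ to $G_R$, $B$ is carried into $\mathrm{Aut}_c(\mathrm{K}_G)$. -}

module Defs where

open import Data.Nat using (ℕ)
open import Data.Fin using (Fin)
open import Data.Bool using (Bool; true; false; T)
open import Data.Product using (Σ; ∃; ∃-syntax; _×_; _,_; proj₁)
open import Data.Sum using (_⊎_)
open import Relation.Nullary using (¬_)
open import Relation.Binary.PropositionalEquality using (_≡_)
open import Function.Bundles using (_↔_; Inverse)
open import Function.Construct.Composition using (_↔-∘_)
open import Function.Construct.Symmetry using (↔-sym)
open import Function.Properties.Inverse using (↔-refl)

-- Convention (as in the paper): permutations act on the RIGHT, so the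
-- product p ⋆ q means "first p, then q", i.e. δ^(pq) = (δ^p)^q.

Perm : Set → Set
Perm Δ = Δ ↔ Δ

module _ {Δ : Set} where

  _^_ : Δ → Perm Δ → Δ
  δ ^ p = Inverse.to p δ

  _≈_ : Perm Δ → Perm Δ → Set
  p ≈ q = ∀ δ → δ ^ p ≡ δ ^ q

  idP : Perm Δ
  idP = ↔-refl

  _⋆_ : Perm Δ → Perm Δ → Perm Δ
  p ⋆ q = q ↔-∘ p

  _⁻¹ : Perm Δ → Perm Δ
  p ⁻¹ = ↔-sym p

  record IsPermGroup (P : Perm Δ → Set) : Set where
    field
      id-closed  : P idP
      ⋆-closed   : ∀ {p q} → P p → P q → P (p ⋆ q)
      inv-closed : ∀ {p} → P p → P (p ⁻¹)
      resp-≈     : ∀ {p q} → p ≈ q → P p → P q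

  _⊆ₚ_ : (Perm Δ → Set) → (Perm Δ → Set) → Set
  P ⊆ₚ Q = ∀ {p} → P p → Q p

  Regular : (Perm Δ → Set) → Set
  Regular P =
    (∀ δ δ′ → ∃[ g ] (P g × δ ^ g ≡ δ′)) ×
    (∀ g g′ δ → P g → P g′ → δ ^ g ≡ δ ^ g′ → g ≈ g′)

  IsAbelian : (Perm Δ → Set) → Set
  IsAbelian P = ∀ a b → P a → P b → (a ⋆ b) ≈ (b ⋆ a)

  IsElemAb2 : (Perm Δ → Set) → Set
  IsElemAb2 P = IsAbelian P × (∀ a → P a → (a ⋆ a) ≈ idP)

  IsSubgroup : (Perm Δ → Set) → (Perm Δ → Set) → Set
  IsSubgroup A P = (A ⊆ₚ P) × IsPermGroup A

  -- P is (isomorphic to) a generalised dicyclic group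
  --   < A, x | x^2 = y, x^-1 a x = a^-1 (a ∈ A) >
  -- over an abelian group A of even order and exponent > 2 with an
  -- involution y ∈ A: A is an abelian subgroup of index 2 in P (P = A ∪ Ax,
  -- x ∉ A) satisfying the defining relations.  (Even order of A follows
  -- from A containing the involution y.)
  IsGenDicyclic : (Perm Δ → Set) → Set₁
  IsGenDicyclic P =
    Σ (Perm Δ → Set) λ A → Σ (Perm Δ) λ x → Σ (Perm Δ) λ y →
      IsSubgroup A P × IsAbelian A ×
      (∃[ a ] (A a × ¬ ((a ⋆ a) ≈ idP))) ×
      A y × ¬ (y ≈ idP) × (y ⋆ y) ≈ idP ×
      P x × ¬ A x ×
      (∀ g → P g → A g ⊎ (∃[ a ] (A a × g ≈ (a ⋆ x)))) ×
      (x ⋆ x) ≈ y ×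
      (∀ a → A a → ((x ⁻¹) ⋆ (a ⋆ x)) ≈ (a ⁻¹))

  -- the colour {s, s⁻¹} of an edge of a Cayley graph: same colour
  SameColour : Perm Δ → Perm Δ → Set
  SameColour s t = s ≈ t ⊎ s ≈ (t ⁻¹)

  -- complete colour pair (P, Q): P a regular subgroup of the permutation
  -- group Q on Δ, with (a) and (b).
  -- (b): a bijection φ : Δ → P (P taken up to ≈), carrying the action of P
  -- to the right regular action, φ(δ^x) = φ(δ) x, such that every b ∈ Q is
  -- carried into Aut_c(K_P): for distinct vertices φ δ, φ δ′ of K_P, the
  -- edge colour {φ δ′ (φ δ)⁻¹, ...} equals that of the image edge.
  CompleteColourPair : (Perm Δ → Set) → (Perm Δ → Set) → Set₁
  CompleteColourPair P Q =
    IsPermGroup Q × IsSubgroup P Q × Regular P ×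
    (((IsAbelian P × ¬ IsElemAb2 P)) ⊎ IsGenDicyclic P) ×
    Σ (Δ → Perm Δ) λ φ →
      (∀ δ → P (φ δ)) ×
      (∀ δ δ′ → φ δ ≈ φ δ′ → δ ≡ δ′) ×
      (∀ g → P g → ∃[ δ ] (φ δ ≈ g)) ×
      (∀ δ x → P x → φ (δ ^ x) ≈ (φ δ ⋆ x)) ×
      (∀ b → Q b → ∀ δ δ′ → ¬ δ ≡ δ′ →
         SameColour (φ δ′ ⋆ (φ δ ⁻¹))
                    (φ (δ′ ^ b) ⋆ (φ (δ ^ b) ⁻¹)))

record Graph : Set where
  field
    n      : ℕ
    adj    : Fin n → Fin n → Bool
    sym    : ∀ u v → adj u v ≡ adj v u
    irrefl : ∀ v → adj v v ≡ false

module _ (Γ : Graph) where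
  open Graph Γ

  Adj : Fin n → Fin n → Set
  Adj u v = T (adj u v)

  data Walk : Fin n → Fin n → Set where
    here : ∀ {u} → Walk u u
    step : ∀ {u v w} → Adj u v → Walk v w → Walk u w

  Connected : Set
  Connected = ∀ u v → Walk u v

  IsAut : Perm (Fin n) → Set
  IsAut p = ∀ u v → adj (u ^ p) (v ^ p) ≡ adj u v

  IsAutGroup : (Perm (Fin n) → Set) → Set
  IsAutGroup X = IsPermGroup X × (∀ p → X p → IsAut p)

  ArcRegular : (Perm (Fin n) → Set) → Set
  ArcRegular X =
    (∀ u v u′ v′ → Adj u v → Adj u′ v′ →
       ∃[ g ] (X g × u ^ g ≡ u′ × v ^ g ≡ v′)) ×
    (∀ u v g g′ → Adj u v → X g → X g′ →
       u ^ g ≡ u ^ g′ → v ^ g ≡ v ^ g′ → g ≈ g′)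

  Nbhd : Fin n → Set
  Nbhd v = Σ (Fin n) λ w → Adj v w

  Induced : (Perm (Fin n) → Set) → (v : Fin n) → Perm (Nbhd v) → Set
  Induced X v σ =
    ∃[ g ] (X g × v ^ g ≡ v × (∀ (w : Nbhd v) → proj₁ (w ^ σ) ≡ proj₁ w ^ g))

  -- Vertices of L(S(Γ)) = edges {u, m_uv} of S(Γ)
  -- = arcs (u , v) of Γ; two distinct such edges are adjacent iff they
  -- share the original vertex u or the subdivision vertex m_uv.
  LSAdj : (Fin n × Fin n) → (Fin n × Fin n) → Set
  LSAdj (u , v) (u′ , v′) =
    ¬ ((u , v) ≡ (u′ , v′)) × (u ≡ u′ ⊎ (u ≡ v′ × v ≡ u′))

Fin′ : Graph → Set
Fin′ Γ = Fin (Graph.n Γ)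

{-# OPTIONS --safe #-}
module Submission where

open import Defs
open import Data.Bool.Properties using (T-irrelevant)
open import Data.Bool using (T)
open import Data.Product using (_×_; _,_; proj₁; proj₂)
open import Data.Product.Properties using (Σ-≡,≡→≡; ,-injective)
open import Data.Sum using (_⊎_; inj₁; inj₂)
open import Relation.Nullary using (¬_)
open import Relation.Binary.PropositionalEquality
  using (_≡_; refl; sym; trans; cong; cong₂; subst; subst₂; module ≡-Reasoning)
open import Function.Bundles using (Inverse; mk↔ₛ′)

-- Two arcs of Γ adjacent in L(S(Γ)) either share their tail or are mutually
-- reverse.  Write s = g′g⁻¹ and s₁ = g₁′g₁⁻¹ for the colours of the edge and
-- of its image under h.  Reverse arcs: s and s₁ both reverse the base arc
-- (u₀, v₀), so s = s₁ by arc-regularity.  Common tail: s and s₁ fix u₀, and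
-- k = g h g₁⁻¹ ∈ H fixes the base arc and conjugates s to s₁ on it.  Acting
-- on Γ(u₀), k is a colour-preserving automorphism of Cay(G_{u₀}^{Γ(u₀)}, ·)
-- fixing v₀, so it sends v₀^s to v₀^s or v₀^{s⁻¹}; arc-regularity upgrades
-- this to s₁ = s or s₁ = s⁻¹.

module _ {Δ : Set} where

  ⁻¹-cancelʳ : (p : Perm Δ) (x : Δ) → (x ^ p) ^ (p ⁻¹) ≡ x
  ⁻¹-cancelʳ p x = Inverse.inverseʳ p refl

  ⁻¹-cancelˡ : (p : Perm Δ) (x : Δ) → (x ^ (p ⁻¹)) ^ p ≡ x
  ⁻¹-cancelˡ p x = Inverse.inverseˡ p refl

  ^-injective : (p : Perm Δ) {x y : Δ} → x ^ p ≡ y ^ p → x ≡ y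
  ^-injective p {x} {y} e = begin
    x                   ≡⟨ sym (⁻¹-cancelʳ p x) ⟩
    (x ^ p) ^ (p ⁻¹)    ≡⟨ cong (_^ (p ⁻¹)) e ⟩
    (y ^ p) ^ (p ⁻¹)    ≡⟨ ⁻¹-cancelʳ p y ⟩
    y                   ∎
    where open ≡-Reasoning

  ^-transpose : ∀ (p : Perm Δ) {x y} → x ^ p ≡ y → y ^ (p ⁻¹) ≡ x
  ^-transpose p {x} e = trans (cong (_^ (p ⁻¹)) (sym e)) (⁻¹-cancelʳ p x)

  ^-⋆⁻¹ : ∀ (p q : Perm Δ) {x y} → x ^ q ≡ y ^ p → x ^ (q ⋆ (p ⁻¹)) ≡ y
  ^-⋆⁻¹ p q e = ^-transpose p (sym e)

  ⋆≈idP⇒≈⁻¹ : ∀ {p q : Perm Δ} → (p ⋆ q) ≈ idP → p ≈ (q ⁻¹)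
  ⋆≈idP⇒≈⁻¹ {p} {q} pq≈id x = begin
    x ^ p                    ≡⟨ sym (⁻¹-cancelʳ q (x ^ p)) ⟩
    ((x ^ p) ^ q) ^ (q ⁻¹)   ≡⟨ cong (_^ (q ⁻¹)) (pq≈id x) ⟩
    x ^ (q ⁻¹)               ∎
    where open ≡-Reasoning

  distinct-^ : ∀ (p : Perm Δ) {x y x′ y′ : Δ} → ¬ (x , y) ≡ (x′ , y′) →
               ¬ (x ^ p , y ^ p) ≡ (x′ ^ p , y′ ^ p)
  distinct-^ p distinct e with ,-injective e
  ... | ex , ey = distinct (cong₂ _,_ (^-injective p ex) (^-injective p ey))

  -- The right disjunct says δ^τ = δ^{σ⁻¹}.  With c = φ δ, the colour
  -- condition for the edge {δ, δ^σ} reads cσc⁻¹ = cτc⁻¹ or cσc⁻¹ = cτ⁻¹c⁻¹.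
  CompleteColourPair⇒fixer-preserves-colour :
    ∀ {P Q : Perm Δ → Set} → CompleteColourPair P Q →
    ∀ {b σ τ δ} → Q b → P σ → P τ →
    δ ^ b ≡ δ → ¬ δ ≡ δ ^ σ → (δ ^ σ) ^ b ≡ δ ^ τ →
    δ ^ σ ≡ δ ^ τ ⊎ (δ ^ σ) ^ τ ≡ δ
  CompleteColourPair⇒fixer-preserves-colour
    (_ , _ , _ , _ , φ , _ , φ-injective , _ , φ-^ , φ-colour)
    {b} {σ} {τ} {δ} Qb Pσ Pτ δb≡δ δ≢δσ δσb≡δτ
    with subst₂ (λ β α → SameColour (φ (δ ^ σ) ⋆ (φ δ ⁻¹)) (φ β ⋆ (φ α ⁻¹)))
                δσb≡δτ δb≡δ (φ-colour b Qb δ (δ ^ σ) δ≢δσ)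
  ... | inj₁ same = inj₁ (φ-injective _ _ λ x → ^-injective (φ δ ⁻¹) (same x))
  ... | inj₂ inverse = inj₂ (φ-injective _ _ λ x → let z = x ^ φ (δ ^ σ) in begin
    x ^ φ ((δ ^ σ) ^ τ)                         ≡⟨ φ-^ (δ ^ σ) τ Pτ x ⟩
    z ^ τ                                       ≡˘⟨ cong (_^ τ) (⁻¹-cancelˡ (φ δ) z) ⟩
    ((z ^ (φ δ ⁻¹)) ^ φ δ) ^ τ                  ≡˘⟨ φ-^ δ τ Pτ (z ^ (φ δ ⁻¹)) ⟩
    (z ^ (φ δ ⁻¹)) ^ φ (δ ^ τ)                  ≡⟨ cong (_^ φ (δ ^ τ)) (inverse x) ⟩
    ((x ^ φ δ) ^ (φ (δ ^ τ) ⁻¹)) ^ φ (δ ^ τ)    ≡⟨ ⁻¹-cancelˡ (φ (δ ^ τ)) (x ^ φ δ) ⟩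
    x ^ φ δ                                     ∎)
    where open ≡-Reasoning

module _ (Γ : Graph) where
  open Graph Γ using (adj)

  Nbhd-≡ : ∀ {v} {w w′ : Nbhd Γ v} → proj₁ w ≡ proj₁ w′ → w ≡ w′
  Nbhd-≡ e = Σ-≡,≡→≡ (e , T-irrelevant _ _)

  IsAut-⁻¹ : ∀ {p} → IsAut Γ p → IsAut Γ (p ⁻¹)
  IsAut-⁻¹ {p} aut u v =
    trans (sym (aut (u ^ (p ⁻¹)) (v ^ (p ⁻¹)))) (cong₂ adj (⁻¹-cancelˡ p u) (⁻¹-cancelˡ p v))

  Nbhd-map : ∀ p {v} → IsAut Γ p → v ^ p ≡ v → Nbhd Γ v → Nbhd Γ v
  Nbhd-map p aut fix (w , vw) =
    w ^ p , subst (λ x → T (adj x (w ^ p))) fix (subst T (sym (aut _ w)) vw)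

  restrict : ∀ p {v} → IsAut Γ p → v ^ p ≡ v → Perm (Nbhd Γ v)
  restrict p aut fix = mk↔ₛ′
    (Nbhd-map p aut fix) (Nbhd-map (p ⁻¹) (IsAut-⁻¹ {p} aut) (^-transpose p fix))
    (λ w → Nbhd-≡ (⁻¹-cancelˡ p (proj₁ w))) (λ w → Nbhd-≡ (⁻¹-cancelʳ p (proj₁ w)))

  restrict-Induced : ∀ {X p v} → X p → (aut : IsAut Γ p) (fix : v ^ p ≡ v) →
                     Induced Γ X v (restrict p aut fix)
  restrict-Induced {p = p} Xp _ fix = p , Xp , fix , λ _ → refl

  LSAdj-^ : ∀ (p : Perm (Fin′ Γ)) {u v u′ v′} → LSAdj Γ (u , v) (u′ , v′) →
            LSAdj Γ (u ^ p , v ^ p) (u′ ^ p , v′ ^ p)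
  LSAdj-^ p (distinct , inj₁ tail) = distinct-^ p distinct , inj₁ (cong (_^ p) tail)
  LSAdj-^ p (distinct , inj₂ (uv′ , vu′)) =
    distinct-^ p distinct , inj₂ (cong (_^ p) uv′ , cong (_^ p) vu′)

module ColourTransport
  (Γ : Graph) {G H : Perm (Fin′ Γ) → Set}
  (GA : IsAutGroup Γ G) (HA : IsAutGroup Γ H) (G⊆H : G ⊆ₚ H) (AR : ArcRegular Γ G)
  {u₀ v₀ : Fin′ Γ} (a₀ : Adj Γ u₀ v₀)
  {h g g′ g₁ g₁′ : Perm (Fin′ Γ)}
  (Hh : H h) (Gg : G g) (Gg′ : G g′) (Gg₁ : G g₁) (Gg₁′ : G g₁′)
  (h-arc  : (u₀ ^ g₁ , v₀ ^ g₁) ≡ ((u₀ ^ g) ^ h , (v₀ ^ g) ^ h))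
  (h-arc′ : (u₀ ^ g₁′ , v₀ ^ g₁′) ≡ ((u₀ ^ g′) ^ h , (v₀ ^ g′) ^ h))
  where

  private
    module G = IsPermGroup (proj₁ GA)
    module H = IsPermGroup (proj₁ HA)

    hu : u₀ ^ g₁ ≡ (u₀ ^ g) ^ h
    hu = proj₁ (,-injective h-arc)

    hv : v₀ ^ g₁ ≡ (v₀ ^ g) ^ h
    hv = proj₂ (,-injective h-arc)

    hu′ : u₀ ^ g₁′ ≡ (u₀ ^ g′) ^ h
    hu′ = proj₁ (,-injective h-arc′)

    hv′ : v₀ ^ g₁′ ≡ (v₀ ^ g′) ^ h
    hv′ = proj₂ (,-injective h-arc′)

  s s₁ : Perm (Fin′ Γ)
  s = g′ ⋆ (g ⁻¹)
  s₁ = g₁′ ⋆ (g₁ ⁻¹)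

  G-s : G s
  G-s = G.⋆-closed Gg′ (G.inv-closed Gg)

  G-s₁ : G s₁
  G-s₁ = G.⋆-closed Gg₁′ (G.inv-closed Gg₁)

  G-unique : ∀ {a b} → G a → G b → u₀ ^ a ≡ u₀ ^ b → v₀ ^ a ≡ v₀ ^ b → a ≈ b
  G-unique Ga Gb = proj₂ AR u₀ v₀ _ _ a₀ Ga Gb

  s₁-maps-like-s : ∀ {x y} → x ^ g₁′ ≡ (x ^ g′) ^ h → y ^ g₁ ≡ (y ^ g) ^ h →
            x ^ g′ ≡ y ^ g → x ^ s₁ ≡ y
  s₁-maps-like-s hx hy e = ^-⋆⁻¹ g₁ g₁′ (trans hx (trans (cong (_^ h) e) (sym hy)))

  reverse-arcs-colour : u₀ ^ g ≡ v₀ ^ g′ → v₀ ^ g ≡ u₀ ^ g′ → SameColour s s₁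
  reverse-arcs-colour uv′ vu′ = inj₁ (G-unique G-s G-s₁
    (trans (^-⋆⁻¹ g g′ (sym vu′)) (sym (s₁-maps-like-s hu′ hv (sym vu′))))
    (trans (^-⋆⁻¹ g g′ (sym uv′)) (sym (s₁-maps-like-s hv′ hu (sym uv′)))))

  H-aut : ∀ p → H p → IsAut Γ p
  H-aut = proj₂ HA

  k : Perm (Fin′ Γ)
  k = (g ⋆ h) ⋆ (g₁ ⁻¹)

  H-k : H k
  H-k = H.⋆-closed (H.⋆-closed (G⊆H Gg) Hh) (H.inv-closed (G⊆H Gg₁))

  k-fixes-u₀ : u₀ ^ k ≡ u₀
  k-fixes-u₀ = ^-⋆⁻¹ g₁ (g ⋆ h) (sym hu)

  k-fixes-v₀ : v₀ ^ k ≡ v₀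
  k-fixes-v₀ = ^-⋆⁻¹ g₁ (g ⋆ h) (sym hv)

  k-conjugates : (v₀ ^ s) ^ k ≡ v₀ ^ s₁
  k-conjugates = cong (_^ (g₁ ⁻¹)) (trans (cong (_^ h) (⁻¹-cancelˡ g (v₀ ^ g′))) (sym hv′))

  κ : Perm (Nbhd Γ u₀)
  κ = restrict Γ k (H-aut k H-k) k-fixes-u₀

  module _ (tail : u₀ ^ g ≡ u₀ ^ g′) where

    s-fixes-u₀ : u₀ ^ s ≡ u₀
    s-fixes-u₀ = ^-⋆⁻¹ g g′ (sym tail)

    s₁-fixes-u₀ : u₀ ^ s₁ ≡ u₀
    s₁-fixes-u₀ = s₁-maps-like-s hu′ hu (sym tail)

    σ σ₁ : Perm (Nbhd Γ u₀)
    σ = restrict Γ s (H-aut s (G⊆H G-s)) s-fixes-u₀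
    σ₁ = restrict Γ s₁ (H-aut s₁ (G⊆H G-s₁)) s₁-fixes-u₀

  common-tail-colour : CompleteColourPair (Induced Γ G u₀) (Induced Γ H u₀) →
                       ¬ (u₀ ^ g , v₀ ^ g) ≡ (u₀ ^ g′ , v₀ ^ g′) →
                       u₀ ^ g ≡ u₀ ^ g′ → SameColour s s₁
  common-tail-colour ccp distinct tail
    with CompleteColourPair⇒fixer-preserves-colour ccp {κ} {σ tail} {σ₁ tail} {v₀ , a₀}
           (restrict-Induced Γ H-k (H-aut k H-k) k-fixes-u₀)
           (restrict-Induced Γ G-s (H-aut s (G⊆H G-s)) (s-fixes-u₀ tail))
           (restrict-Induced Γ G-s₁ (H-aut s₁ (G⊆H G-s₁)) (s₁-fixes-u₀ tail))
           (Nbhd-≡ Γ k-fixes-v₀) v₀≢v₀^s (Nbhd-≡ Γ k-conjugates)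
    where
      v₀≢v₀^s : ¬ (v₀ , a₀) ≡ (v₀ , a₀) ^ σ tail
      v₀≢v₀^s e = distinct (cong₂ _,_ tail
        (trans (cong (_^ g) (cong proj₁ e)) (⁻¹-cancelˡ g (v₀ ^ g′))))
  ... | inj₁ same = inj₁ (G-unique G-s G-s₁
          (trans (s-fixes-u₀ tail) (sym (s₁-fixes-u₀ tail))) (cong proj₁ same))
  ... | inj₂ inverse = inj₂ (⋆≈idP⇒≈⁻¹ {p = s} {s₁} (G-unique (G.⋆-closed G-s G-s₁) G.id-closed
          (trans (cong (_^ s₁) (s-fixes-u₀ tail)) (s₁-fixes-u₀ tail)) (cong proj₁ inverse)))

  colour-preserved : CompleteColourPair (Induced Γ G u₀) (Induced Γ H u₀) →
                     LSAdj Γ (u₀ ^ g , v₀ ^ g) (u₀ ^ g′ , v₀ ^ g′) → SameColour s s₁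
  colour-preserved ccp (distinct , inj₁ tail) = common-tail-colour ccp distinct tail
  colour-preserved _ (_ , inj₂ (uv′ , vu′)) = reverse-arcs-colour uv′ vu′

corollary4p10 :
    (Γ : Graph) → Connected Γ →
    (G H : Perm (Fin′ Γ) → Set) →
    IsAutGroup Γ G → IsAutGroup Γ H → G ⊆ₚ H →
    ArcRegular Γ G →
    (∀ v → CompleteColourPair (Induced Γ G v) (Induced Γ H v)) →
    -- fix an edge e = {u₀, m_{u₀v₀}} of S(Γ), i.e. the arc (u₀ , v₀);
    -- vertex e^g of L(S(Γ)) is identified with g ∈ G
    ∀ u₀ v₀ → Adj Γ u₀ v₀ →
    ∀ h → H h →
      -- h is an automorphism of L(S(Γ)) ...
      (∀ u v u′ v′ → Adj Γ u v → Adj Γ u′ v′ →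
         LSAdj Γ (u , v) (u′ , v′) →
         LSAdj Γ (u ^ h , v ^ h) (u′ ^ h , v′ ^ h)) ×
      -- ... preserving the colours of Cay(G, S) ≅ L(S(Γ))
      (∀ g g′ g₁ g₁′ → G g → G g′ → G g₁ → G g₁′ →
         LSAdj Γ (u₀ ^ g , v₀ ^ g) (u₀ ^ g′ , v₀ ^ g′) →
         (u₀ ^ g₁ , v₀ ^ g₁) ≡ ((u₀ ^ g) ^ h , (v₀ ^ g) ^ h) →
         (u₀ ^ g₁′ , v₀ ^ g₁′) ≡ ((u₀ ^ g′) ^ h , (v₀ ^ g′) ^ h) →
         SameColour (g′ ⋆ (g ⁻¹)) (g₁′ ⋆ (g₁ ⁻¹)))
corollary4p10 Γ _ G H GA HA G⊆H AR ccp u₀ v₀ a₀ h Hh =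
    (λ _ _ _ _ _ _ → LSAdj-^ Γ h)
  , λ _ _ _ _ Gg Gg′ Gg₁ Gg₁′ adjacent h-arc h-arc′ →
      ColourTransport.colour-preserved Γ GA HA G⊆H AR a₀ Hh Gg Gg′ Gg₁ Gg₁′ h-arc h-arc′
        (ccp u₀) adjacent
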